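{- Let $X$ be a Cantor set, $\sigma$ a homeomorphism of $X$ such that $(X,\sigma)$ has the lifting property, and let $\phi:(X,\sigma)\to(W_n,R_n)$ be a continuous surjection. Then there is a sequence $(P_i)_{i\in\mathbb{N}}$ of partitions of $X$ into clopen sets, all containing the same number of sets, such that each $P_i$ refines $A_\phi$, and there is no positive integer $k$ such that for infinitely many $i\in\mathbb{N}$ there exists a continuous surjection $\psi_i:(X,\sigma)\to(W_{n+k},R_{n+k})$ with $A_{\psi_i}$ refining $P_i$ and $\phi=\xi\circ\psi_i$.
   Context: Spirals: for $n\ge1$ let $L_n=\{l\}\times\{0,\dots,n!-1\}$, $\tilde R_n=\{r\}\times\{0,\dots,n!-1\}$, $M_n=\{m\}\times\{ -n+1,\dots,n-1\}$, and $S_n=L_n\cup M_n\cup\tilde R_n$. The relation $R_n$ on $S_n$ consists of: $(l,k)R_n(l,k+1)$ and $(r,k)R_n(r,k+1)$ for $0\le k<n!-1$; $(l,n!-1)R_n(l,0)$; $(r,n!-1)R_n(r,0)$; $(m,k)R_n(m,k+1)$ for $-n+1\le k<n-1$; $(l,0)R_n(m,-n+1)$; $(m,n-1)R_n(r,0)$. Define maps $S_{n+1}\to S_n$: $\xi_L(a,k)=(l,k\bmod n!)$, $\xi_G(a,k)=(r,k\bmod n!)$, and $\xi_M(a,k)=(a,k\bmod n!)$ if $a\in\{l,r\}$, $\xi_M(m,k)=(m,k)$ if $-n+1\le k\le n-1$, $\xi_M(m,-n)=(l,0)$, $\xi_M(m,n)=(r,0)$. Let $W_n$ be the disjoint union of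 $6^n$ copies of $S_n$ indexed by the words of length $n$ over the alphabet $\{L_1,L_2,M_1,M_2,G_1,G_2\}$, with the discrete topology, and let $R_n$ also denote the union of the relations on the copies. The canonical map $\xi:W_{n+1}\to W_n$ sends a point of the copy indexed by a word $wa$ (last letter $a$) to the copy indexed by $w$ via $\xi_L$ if $a\in\{L_1,L_2\}$, $\xi_M$ if $a\in\{M_1,M_2\}$, $\xi_G$ if $a\in\{G_1,G_2\}$; composites give canonical maps $\xi:W_{n+k}\to W_n$. Writing $\phi:(X,\sigma)\to(W_n,R_n)$ means $\phi:X\to W_n$ is a continuous surjection with $\phi(x)R_n\phi(\sigma(x))$ for all $x$. For a continuous surjection $\phi$ onto a finite discrete set $Y$, $A_\phi=\{\phi^{ -1}(y):y\in Y\}$, and its mesh size is the maximum diameter of its members (for a fixed compatible metric). $(X,\sigma)$ has the lifting property if for every $\epsilon>0$, every $n$ and every $\phi:(X,\sigma)\to(W_n,R_n)$ there exist $k\ge1$ and $\psi:(X,\sigma)\to(W_{n+k},R_{n+k})$ with $A_\psi$ of mesh size less than $\epsilon$ and $\phi=\xi\circ\psi$. -}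

module Defs where

open import Data.Nat using (ℕ; zero; suc; _+_; _*_; _∸_; _≤_; _<_; _<?_; pred; NonZero)
open import Data.Nat.Properties using (_!≢0)
open import Data.Nat.DivMod using (_mod_)
open import Data.Nat.Base using (_!)
open import Data.Fin using (Fin; toℕ; fromℕ<)
open import Data.Vec using (Vec; []; _∷_)
open import Data.Bool using (Bool)
open import Data.Product using (Σ; ∃; _×_; _,_)
open import Data.Sum using (_⊎_)
open import Data.Empty using (⊥)
open import Relation.Nullary using (yes; no)
open import Relation.Binary.PropositionalEquality using (_≡_)

_mod!_ : ℕ → (n : ℕ) → Fin (n !)
a mod! n = _mod_ a (n !) {{n !≢0}}

-- number of points of M_n = {-n+1,…,n-1}, i.e. 2n-1
mlen : ℕ → ℕ
mlen n = pred (n + n)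

-- (l , i) , (r , i) for i ∈ {0,…,n!-1};
-- (m , j) represents the point (m , j - (n-1)) of M_n, j ∈ {0,…,2n-2}
data S (n : ℕ) : Set where
  l : Fin (n !) → S n
  r : Fin (n !) → S n
  m : Fin (mlen n) → S n

CycR : (n : ℕ) → Fin (n !) → Fin (n !) → Set
CycR n i j = (suc (toℕ i) ≡ toℕ j) ⊎ ((suc (toℕ i) ≡ n !) × (toℕ j ≡ 0))

RS : (n : ℕ) → S n → S n → Set
RS n (l i) (l j) = CycR n i j
RS n (r i) (r j) = CycR n i j
RS n (m i) (m j) = suc (toℕ i) ≡ toℕ j
-- (l,0) R (m,-n+1)
RS n (l i) (m j) = (toℕ i ≡ 0) × (toℕ j ≡ 0)
-- (m,n-1) R (r,0)   [index of n-1 is 2n-2]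
RS n (m i) (r j) = (suc (suc (toℕ i)) ≡ n + n) × (toℕ j ≡ 0)
RS n _ _ = ⊥

-- for (m , j) in S_{n+1} the integer coordinate is k = j - n ∈ {-n,…,n};
-- k mod n! is computed as (j + n·n! - n) mod n!  (nonnegative residue)
mmod : (n : ℕ) → Fin (mlen (suc n)) → Fin (n !)
mmod n j = (toℕ j + n * n ! ∸ n) mod! n

ξL : (n : ℕ) → S (suc n) → S n
ξL n (l i) = l (toℕ i mod! n)
ξL n (r i) = l (toℕ i mod! n)
ξL n (m j) = l (mmod n j)

ξG : (n : ℕ) → S (suc n) → S n
ξG n (l i) = r (toℕ i mod! n)
ξG n (r i) = r (toℕ i mod! n)
ξG n (m j) = r (mmod n j)

ξMm : (n : ℕ) → ℕ → S n
ξMm n zero = l (0 mod! n)                      -- k = -n  ↦ (l,0)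
ξMm n (suc j) with j <? mlen n
... | yes p = m (fromℕ< p)                        -- -n < k < n ↦ (m,k)
... | no _  = r (0 mod! n)                     -- k = n ↦ (r,0)

ξM : (n : ℕ) → S (suc n) → S n
ξM n (l i) = l (toℕ i mod! n)
ξM n (r i) = r (toℕ i mod! n)
ξM n (m j) = ξMm n (toℕ j)

data Letter : Set where
  L₁ L₂ M₁ M₂ G₁ G₂ : Letter

-- A word of length n, stored REVERSED: the head of the vector is the
-- last letter of the word (so a word "w a" is represented as a ∷ w').
Word : ℕ → Set
Word n = Vec Letter n

W : ℕ → Set
W n = Word n × S n

RW : (n : ℕ) → W n → W n → Set
RW n (w , s) (w' , s') = (w ≡ w') × RS n s s'

ξletter : (n : ℕ) → Letter → S (suc n) → S n
ξletter n L₁ = ξL n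
ξletter n L₂ = ξL n
ξletter n M₁ = ξM n
ξletter n M₂ = ξM n
ξletter n G₁ = ξG n
ξletter n G₂ = ξG n

ξ₁ : (n : ℕ) → W (suc n) → W n
ξ₁ n (a ∷ w , s) = w , ξletter n a s

ξ : (k n : ℕ) → W (k + n) → W n
ξ zero    n x = x
ξ (suc k) n x = ξ k n (ξ₁ (k + n) x)

-- The Cantor set, realised as Cantor space 2^ℕ with the product topology.
X : Set
X = ℕ → Bool

Agree : ℕ → X → X → Set
Agree N x y = ∀ i → i < N → x i ≡ y i

-- continuity of a map into a discrete set (X compact: locally constant,
-- uniformly)
Cont : {A : Set} → (X → A) → Set
Cont f = ∃ λ N → ∀ x y → Agree N x y → f x ≡ f y

Surj : {A : Set} → (X → A) → Set
Surj {A} f = ∀ (a : A) → ∃ λ x → f x ≡ a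

ContX : (X → X) → Set
ContX g = ∀ N → ∃ λ M → ∀ x y → Agree M x y → Agree N (g x) (g y)

_≈X_ : X → X → Set
x ≈X y = ∀ i → x i ≡ y i

IsHomeo : (X → X) → Set
IsHomeo σ = ContX σ × Σ (X → X) λ τ →
  ContX τ × (∀ x → σ (τ x) ≈X x) × (∀ x → τ (σ x) ≈X x)

IsMor : (σ : X → X) (n : ℕ) → (X → W n) → Set
IsMor σ n φ = Cont φ × Surj φ × (∀ x → RW n (φ x) (φ (σ x)))

-- "A_ψ has mesh size < ε" for the metric d(x,y) = 2^{-min{i : x i ≠ y i}},
-- with ε = 2^{-N}: points in the same member of A_ψ agree on N coordinates
FineMesh : {A : Set} → ℕ → (X → A) → Set
FineMesh N ψ = ∀ x y → ψ x ≡ ψ y → Agree N x y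

Lifting : (X → X) → Set
Lifting σ = ∀ (N n : ℕ) → 1 ≤ n → (φ : X → W n) → IsMor σ n φ →
  ∃ λ k → 1 ≤ k × Σ (X → W (k + n)) λ ψ →
    IsMor σ (k + n) ψ × FineMesh N ψ × (∀ x → φ x ≡ ξ k n (ψ x))

-- A_f refines A_g (each member of A_f lies in a member of A_g)
Refines : {A B : Set} → (X → A) → (X → B) → Set
Refines f g = ∀ x y → f x ≡ f y → g x ≡ g y

-- Lift φ to ever deeper levels ψ_i : X → W (K_i + n), K_i → ∞, and let P_i record the
-- class of φ together with one bit of ψ_i: the parity of the last letter of the word,
-- xor-ed with whether the spiral point is one of the origins (l,0), (r,0).  Twinning
-- the last letter (L₁ ↔ L₂, …) flips the bit without changing the image under ξ, so
-- P_i always has 2·|W n| members.  Now let ψ : X → W (k + n) refine P_i with k + n below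
-- the level K_i + n of ψ_i.  Pick x with ψ x on the left loop of S_{k+n} and follow the
-- backward σ-orbit of x: under ψ it stays on that loop and repeats with period (k + n)!,
-- while under ψ_i the word is constant and the spiral point moves backwards through
-- S_{K_i+n}, whose loops are longer than (k + n)!.  Hence at some time A it is at an
-- origin and at time A + (k + n)! it is not, so the bit, hence P_i, separates two points
-- with the same ψ-value.
module Submission where

open import Defs
open import Data.Nat using (ℕ; zero; suc; _+_; _*_; _∸_; _!; _≤_; _<_; _≡ᵇ_; pred; z≤n; s≤s)
open import Data.Nat.Properties
  using ( suc-injective; ≡-irrelevant; 0≢1+n; +-identityʳ; +-suc; +-assoc; m∸n+n≡m; m+[n∸m]≡n; <⇒≤pred
        ; suc-pred; ≤-refl; ≤-trans; ≤-<-trans; m≤n+m; m<m+n; *-mono-≤; +-monoˡ-<; 1≤n!; _!≢0)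
open import Data.Nat.GeneralisedArithmetic using (fold)
open import Data.Nat.Tactic.RingSolver using (solve-∀)
open import Data.Fin using (Fin; toℕ)
open import Data.Fin.Patterns using (0F; 1F; 2F; 3F; 4F; 5F)
open import Data.Fin.Properties using (toℕ-injective; toℕ<n; +↔⊎; *↔×; 1↔⊤; 2↔Bool)
open import Data.Vec using (Vec; []; _∷_; uncons; replicate)
open import Data.Bool using (Bool; true; false; not; _xor_)
open import Data.Bool.Properties using (not-¬; ¬-not; not-distribʳ-xor) renaming (_≟_ to _≟ᵇ_)
open import Data.Product using (Σ; ∃; _×_; _,_; proj₁; proj₂; uncurry)
open import Data.Product.Function.NonDependent.Propositional using (_×-↔_)
open import Data.Sum using (_⊎_; inj₁; inj₂)
open import Data.Sum.Function.Propositional using (_⊎-↔_)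
open import Data.Empty using (⊥; ⊥-elim)
open import Data.Unit using (tt)
open import Function using (_∘_; _↔_; mk↔ₛ′; Inverse)
open import Function.Properties.Inverse using (↔-refl; ↔-sym; ↔-trans)
open import Relation.Nullary using (¬_; yes; no)
open import Relation.Binary.PropositionalEquality

private
  variable
    A B : Set
    M n : ℕ

Finite : Set → Set
Finite A = Σ ℕ λ c → A ↔ Fin c

finite-↔ : A ↔ B → Finite B → Finite A
finite-↔ A↔B (c , B↔c) = c , ↔-trans A↔B B↔c

finite-Fin : ∀ c → Finite (Fin c)
finite-Fin c = c , ↔-refl

finite-× : Finite A → Finite B → Finite (A × B)
finite-× (c , A↔c) (d , B↔d) = c * d , ↔-trans (A↔c ×-↔ B↔d) (↔-sym *↔×)

finite-⊎ : Finite A → Finite B → Finite (A ⊎ B)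
finite-⊎ (c , A↔c) (d , B↔d) = c + d , ↔-trans (A↔c ⊎-↔ B↔d) (↔-sym +↔⊎)

finite-Vec : Finite A → ∀ n → Finite (Vec A n)
finite-Vec _ zero = finite-↔ (mk↔ₛ′ (λ _ → tt) (λ _ → []) (λ _ → refl) (λ { [] → refl })) (1 , ↔-sym 1↔⊤)
finite-Vec A-finite (suc n) =
  finite-↔ (mk↔ₛ′ uncons (uncurry _∷_) (λ _ → refl) (λ { (_ ∷ _) → refl }))
           (finite-× A-finite (finite-Vec A-finite n))

finite-Bool : Finite Bool
finite-Bool = 2 , ↔-sym 2↔Bool

finite-Letter : Finite Letter
finite-Letter = 6 , mk↔ₛ′ to from to∘from from∘to
  where
  to : Letter → Fin 6
  to L₁ = 0F
  to L₂ = 1F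
  to M₁ = 2F
  to M₂ = 3F
  to G₁ = 4F
  to G₂ = 5F
  from : Fin 6 → Letter
  from 0F = L₁
  from 1F = L₂
  from 2F = M₁
  from 3F = M₂
  from 4F = G₁
  from 5F = G₂
  to∘from : ∀ i → to (from i) ≡ i
  to∘from 0F = refl
  to∘from 1F = refl
  to∘from 2F = refl
  to∘from 3F = refl
  to∘from 4F = refl
  to∘from 5F = refl
  from∘to : ∀ a → from (to a) ≡ a
  from∘to L₁ = refl
  from∘to L₂ = refl
  from∘to M₁ = refl
  from∘to M₂ = refl
  from∘to G₁ = refl
  from∘to G₂ = refl

finite-S : ∀ M → Finite (S M)
finite-S M = finite-↔ S↔⊎ (finite-⊎ (finite-Fin _) (finite-⊎ (finite-Fin _) (finite-Fin _)))
  where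
  S↔⊎ : S M ↔ (Fin (M !) ⊎ (Fin (M !) ⊎ Fin (mlen M)))
  S↔⊎ = mk↔ₛ′ (λ { (l v) → inj₁ v ; (r v) → inj₂ (inj₁ v) ; (m v) → inj₂ (inj₂ v) })
              (λ { (inj₁ v) → l v ; (inj₂ (inj₁ v)) → r v ; (inj₂ (inj₂ v)) → m v })
              (λ { (inj₁ _) → refl ; (inj₂ (inj₁ _)) → refl ; (inj₂ (inj₂ _)) → refl })
              (λ { (l _) → refl ; (r _) → refl ; (m _) → refl })

Classes : ℕ → Set
Classes n = W n × Bool

finite-Classes : ∀ n → Finite (Classes n)
finite-Classes n = finite-× (finite-× (finite-Vec finite-Letter n) (finite-S n)) finite-Bool

-- Twin letters and the label bit

twin : Letter → Letter
twin L₁ = L₂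
twin L₂ = L₁
twin M₁ = M₂
twin M₂ = M₁
twin G₁ = G₂
twin G₂ = G₁

parity : Letter → Bool
parity L₁ = true
parity M₁ = true
parity G₁ = true
parity _  = false

parity-twin : ∀ a → parity (twin a) ≡ not (parity a)
parity-twin L₁ = refl
parity-twin L₂ = refl
parity-twin M₁ = refl
parity-twin M₂ = refl
parity-twin G₁ = refl
parity-twin G₂ = refl

ξletter-twin : ∀ n a → ξletter n (twin a) ≡ ξletter n a
ξletter-twin n L₁ = refl
ξletter-twin n L₂ = refl
ξletter-twin n M₁ = refl
ξletter-twin n M₂ = refl
ξletter-twin n G₁ = refl
ξletter-twin n G₂ = refl

origin : S M → Bool
origin (l v) = toℕ v ≡ᵇ 0
origin (r v) = toℕ v ≡ᵇ 0
origin (m _) = false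

label : W (suc M) → Bool
label (a ∷ _ , s) = origin s xor parity a

twinLast : W (suc M) → W (suc M)
twinLast (a ∷ w , s) = twin a ∷ w , s

label-twinLast : (y : W (suc M)) → label (twinLast y) ≡ not (label y)
label-twinLast (a ∷ _ , s) = trans (cong (origin s xor_) (parity-twin a)) (sym (not-distribʳ-xor (origin s) (parity a)))

ξ₁-twinLast : (y : W (suc M)) → ξ₁ M (twinLast y) ≡ ξ₁ M y
ξ₁-twinLast {M} (a ∷ w , s) = cong (λ f → w , f s) (ξletter-twin M a)

label-adjustable : (y : W (suc M)) (b : Bool) → ∃ λ y′ → ξ₁ M y′ ≡ ξ₁ M y × label y′ ≡ b
label-adjustable y b with label y ≟ᵇ b
... | yes label≡b = y , refl , label≡b
... | no  label≢b = twinLast y , ξ₁-twinLast y , trans (label-twinLast y) (sym (¬-not (label≢b ∘ sym)))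

label-changes-with-origin : {y y′ : W (suc M)} → proj₁ y ≡ proj₁ y′ →
  origin (proj₂ y) ≡ true → origin (proj₂ y′) ≡ false → label y ≢ label y′
label-changes-with-origin {y = a ∷ _ , _} refl o o′ labels rewrite o | o′ = not-¬ refl (sym labels)

data Place : Set where
  left right middle : Place

At : S M → Place → ℕ → Set
At (l v) left   a = toℕ v ≡ a
At (r v) right  a = toℕ v ≡ a
At (m v) middle a = toℕ v ≡ a
At _     _      _ = ⊥

locate : (s : S M) → Σ Place λ p → Σ ℕ (At s p)
locate (l v) = left   , toℕ v , refl
locate (r v) = right  , toℕ v , refl
locate (m v) = middle , toℕ v , refl

At-unique : ∀ {s s′ : S M} p {a} → At s p a → At s′ p a → s ≡ s′
At-unique {s = l v} {l v′} left   e e′ = cong l (toℕ-injective (trans e (sym e′)))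
At-unique {s = r v} {r v′} right  e e′ = cong r (toℕ-injective (trans e (sym e′)))
At-unique {s = m v} {m v′} middle e e′ = cong m (toℕ-injective (trans e (sym e′)))

At-left-bound : ∀ {s : S M} {a} → At s left a → a < M !
At-left-bound {s = l v} refl = toℕ<n v

origin-left-zero : {s : S M} → At s left 0 → origin s ≡ true
origin-left-zero {s = l v} e rewrite e = refl

origin-right-zero : {s : S M} → At s right 0 → origin s ≡ true
origin-right-zero {s = r v} e rewrite e = refl

origin-At-suc : ∀ {s : S M} p {a} → At s p (suc a) → origin s ≡ false
origin-At-suc {s = l v} left   e rewrite e = refl
origin-At-suc {s = r v} right  e rewrite e = refl
origin-At-suc {s = m v} middle e = refl

CycR-pred-suc : ∀ {v′ v : Fin (M !)} {a} → CycR M v′ v → toℕ v ≡ suc a → toℕ v′ ≡ a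
CycR-pred-suc (inj₁ e)       e′ = suc-injective (trans e e′)
CycR-pred-suc (inj₂ (_ , e)) e′ = ⊥-elim (0≢1+n (trans (sym e) e′))

CycR-pred-zero : ∀ {v′ v : Fin (M !)} → CycR M v′ v → toℕ v ≡ 0 → toℕ v′ ≡ pred (M !)
CycR-pred-zero (inj₁ e)       e′ = ⊥-elim (0≢1+n (trans (sym e′) (sym e)))
CycR-pred-zero (inj₂ (e , _)) _  = cong pred e

pred-At-suc : ∀ {s′ s : S M} p {a} → RS M s′ s → At s p (suc a) → At s′ p a
pred-At-suc {M} {s′ = l _} {l _} left   c       e = CycR-pred-suc {M} c e
pred-At-suc {M} {s′ = r _} {r _} right  c       e = CycR-pred-suc {M} c e
pred-At-suc {s′ = m _} {r _} right  (_ , e) e′ = ⊥-elim (0≢1+n (trans (sym e) e′))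
pred-At-suc {s′ = m _} {m _} middle c       e = suc-injective (trans c e)
pred-At-suc {s′ = l _} {m _} middle (_ , e) e′ = ⊥-elim (0≢1+n (trans (sym e) e′))

pred-left-zero : {s′ s : S M} → RS M s′ s → At s left 0 → At s′ left (pred (M !))
pred-left-zero {M} {s′ = l _} {l _} c e = CycR-pred-zero {M} c e

pred-right-zero : {s′ s : S M} → RS M s′ s → At s right 0 →
  At s′ right (pred (M !)) ⊎ ∃ (At s′ middle)
pred-right-zero {M} {s′ = r _} {r _} c e = inj₁ (CycR-pred-zero {M} c e)
pred-right-zero {s′ = m v} {r _} _ _ = inj₂ (toℕ v , refl)

pred-middle-zero : {s′ s : S M} → RS M s′ s → At s middle 0 → At s′ left 0
pred-middle-zero {s′ = m _} {m _} c       e = ⊥-elim (0≢1+n (trans (sym e) (sym c)))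
pred-middle-zero {s′ = l _} {m _} (e , _) _ = e

pred-left : ∀ {s′ s : S M} {a} → RS M s′ s → At s left a → ∃ (At s′ left)
pred-left {a = zero}  c e = _ , pred-left-zero c e
pred-left {a = suc a} c e = a , pred-At-suc left c e

-- Backward orbits

module BackwardOrbit {M : ℕ} (z : ℕ → W M) (step : ∀ j → RW M (z (suc j)) (z j)) where

  state : ℕ → S M
  state j = proj₂ (z j)

  state-step : ∀ j → RS M (state (suc j)) (state j)
  state-step j = proj₂ (step j)

  word-constant : ∀ j → proj₁ (z j) ≡ proj₁ (z 0)
  word-constant zero    = refl
  word-constant (suc j) = trans (proj₁ (step j)) (word-constant j)

  AtTime : ℕ → Place → ℕ → Set
  AtTime j = At (state j)

  same-position⇒same-point : ∀ {i j} p {a} → AtTime i p a → AtTime j p a → z i ≡ z j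
  same-position⇒same-point {i} {j} p hᵢ hⱼ =
    cong₂ _,_ (trans (word-constant i) (sym (word-constant j))) (At-unique p hᵢ hⱼ)

  descend : ∀ t {j p a} → AtTime j p (t + a) → AtTime (j + t) p a
  descend zero    {j} {p} {a} h = subst (λ i → AtTime i p a) (sym (+-identityʳ j)) h
  descend (suc t) {j} {p} {a} h =
    subst (λ i → AtTime i p a) (sym (+-suc j t)) (descend t (pred-At-suc p (state-step j) h))

  descend-to-zero : ∀ {j p a} → AtTime j p a → AtTime (j + a) p 0
  descend-to-zero {a = a} h = descend a (subst (AtTime _ _) (sym (+-identityʳ a)) h)

  middle-to-left-origin : ∀ {j a} → AtTime j middle a → AtTime (suc (j + a)) left 0
  middle-to-left-origin h = pred-middle-zero (state-step _) (descend-to-zero h)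

  left-forever : ∀ {a} → AtTime 0 left a → ∀ j → ∃ (AtTime j left)
  left-forever h zero    = _ , h
  left-forever h (suc j) = pred-left (state-step j) (proj₂ (left-forever h j))

  left-periodic : ∀ {j a} → AtTime j left a → z (j + M !) ≡ z j
  left-periodic {j} {a} h = subst (λ i → z i ≡ z j) once-round (same-position⇒same-point left h′ h)
    where
    rest : ℕ
    rest = pred (M !) ∸ a
    top≡rest+a : pred (M !) ≡ rest + a
    top≡rest+a = sym (m∸n+n≡m (<⇒≤pred (At-left-bound h)))
    h′ : AtTime (suc (j + a) + rest) left a
    h′ = descend rest (subst (AtTime _ left) top≡rest+a (pred-left-zero (state-step _) (descend-to-zero h)))
    once-round : suc (j + a) + rest ≡ j + M !
    once-round = begin
      suc (j + a) + rest      ≡⟨ rearrange j a rest ⟩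
      j + suc (rest + a)      ≡⟨ cong (λ t → j + suc t) (sym top≡rest+a) ⟩
      j + suc (pred (M !))    ≡⟨ cong (j +_) (suc-pred (M !) {{M !≢0}}) ⟩
      j + M !                 ∎
      where
      open ≡-Reasoning
      rearrange : ∀ j a rest → suc (j + a) + rest ≡ j + suc (rest + a)
      rearrange = solve-∀

  Marked : ℕ → ℕ → Set
  Marked p A = origin (state A) ≡ true × origin (state (A + p)) ≡ false

  -- After an origin the point must run down a whole loop of length M! before the next
  -- origin, so it is unmarked p + 1 < M! steps later.
  module _ {p d : ℕ} (top≡p+1+d : pred (M !) ≡ p + suc d) where

    unmarked-after-top : ∀ {j q} → AtTime (suc j) q (pred (M !)) → origin (state (j + suc p)) ≡ false
    unmarked-after-top {j} {q} h =
      subst (λ i → origin (state i) ≡ false) (sym (+-suc j p))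
            (origin-At-suc q (descend p (subst (AtTime _ q) top≡p+1+d h)))

    marked-from-left : ∀ {A} → AtTime A left 0 → Marked (suc p) A
    marked-from-left h = origin-left-zero h , unmarked-after-top (pred-left-zero (state-step _) h)

    marked-from-right : ∀ {A} → AtTime A right 0 → ∃ (Marked (suc p))
    marked-from-right {A} h with pred-right-zero (state-step A) h
    ... | inj₁ top      = A , origin-right-zero h , unmarked-after-top top
    ... | inj₂ (_ , hₘ) = _ , marked-from-left (middle-to-left-origin hₘ)

    marked-somewhere : ∃ (Marked (suc p))
    marked-somewhere with locate (state 0)
    ... | left   , _ , h = _ , marked-from-left (descend-to-zero h)
    ... | right  , _ , h = marked-from-right (descend-to-zero h)
    ... | middle , _ , h = _ , marked-from-left (middle-to-left-origin h)

  marked : ∀ {p} → 0 < p → p < M ! → ∃ (Marked p)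
  marked {suc p} _ p<M! = marked-somewhere top≡p+1+d
    where
    top≡p+1+d : pred (M !) ≡ p + suc (pred (M !) ∸ suc p)
    top≡p+1+d = trans (sym (m+[n∸m]≡n (<⇒≤pred p<M!))) (sym (+-suc p _))

backward-step : ∀ {σ τ : X → X} → (∀ x → σ (τ x) ≈X x) → ∀ {M ψ} → IsMor σ M ψ →
  ∀ y → RW M (ψ (τ y)) (ψ y)
backward-step {τ = τ} στ≈id {ψ = ψ} ((_ , ψ-cont) , _ , ψ-rel) y =
  subst (RW _ (ψ (τ y))) (ψ-cont _ _ (λ i _ → στ≈id y i)) (ψ-rel (τ y))

!-mono-≤ : ∀ {i j} → i ≤ j → i ! ≤ j !
!-mono-≤ {zero}  {zero}  _         = ≤-refl
!-mono-≤ {zero}  {suc j} _         = 1≤n! (suc j)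
!-mono-≤ {suc i} {suc j} (s≤s i≤j) = *-mono-≤ (s≤s i≤j) (!-mono-≤ i≤j)

!-mono-< : ∀ {i j} → 1 ≤ i → i < j → i ! < j !
!-mono-< {i} {suc j} 1≤i (s≤s i≤j) =
  ≤-<-trans (!-mono-≤ i≤j) (m<m+n (j !) (*-mono-≤ (≤-trans 1≤i i≤j) (1≤n! j)))

label-unrefinable : ∀ {σ τ : X → X} → (∀ x → σ (τ x) ≈X x) → ∀ {M N} → M ! < suc N ! →
  {ψ : X → W M} → IsMor σ M ψ → {ψ′ : X → W (suc N)} → IsMor σ (suc N) ψ′ →
  ¬ Refines ψ (label ∘ ψ′)
label-unrefinable {τ = τ} στ≈id {M} M!<N! {ψ} ψ-mor {ψ′} ψ′-mor refines
  with proj₁ (proj₂ ψ-mor) (replicate M L₁ , l (0 mod! M))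
... | x , ψx≡ = separated (High.marked (1≤n! M) M!<N!)
  where
  back : ℕ → X
  back = fold x τ
  module Low  = BackwardOrbit (ψ ∘ back)  (backward-step στ≈id ψ-mor  ∘ back)
  module High = BackwardOrbit (ψ′ ∘ back) (backward-step στ≈id ψ′-mor ∘ back)
  start-left : Low.AtTime 0 left (toℕ (0 mod! M))
  start-left = subst (λ s → At s left _) (sym (cong proj₂ ψx≡)) refl
  separated : ∃ (High.Marked (M !)) → ⊥
  separated (t , origin-at-t , no-origin-later) =
    label-changes-with-origin words-agree origin-at-t no-origin-later (sym labels-agree)
    where
    words-agree : proj₁ (ψ′ (back t)) ≡ proj₁ (ψ′ (back (t + M !)))
    words-agree = trans (High.word-constant t) (sym (High.word-constant (t + M !)))
    labels-agree : label (ψ′ (back (t + M !))) ≡ label (ψ′ (back t))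
    labels-agree = refines _ _ (Low.left-periodic {t} (proj₂ (Low.left-forever start-left t)))

ξ₁-subst : ∀ {u v} (e : u ≡ v) (y : W (suc u)) → ξ₁ v (subst W (cong suc e) y) ≡ subst W e (ξ₁ u y)
ξ₁-subst refl y = refl

ξ-∘ : ∀ a b n (e : a + (b + n) ≡ (a + b) + n) (y : W (a + (b + n))) →
  ξ b n (ξ a (b + n) y) ≡ ξ (a + b) n (subst W e y)
ξ-∘ zero    b n refl y = refl
ξ-∘ (suc a) b n e    y = begin
  ξ b n (ξ a (b + n) (ξ₁ (a + (b + n)) y))          ≡⟨ ξ-∘ a b n e′ (ξ₁ _ y) ⟩
  ξ (a + b) n (subst W e′ (ξ₁ _ y))                  ≡⟨ cong (ξ (a + b) n) (sym (ξ₁-subst e′ y)) ⟩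
  ξ (a + b) n (ξ₁ _ (subst W (cong suc e′) y))       ≡⟨ cong (λ e″ → ξ (a + b) n (ξ₁ _ (subst W e″ y))) (≡-irrelevant _ _) ⟩
  ξ (suc a + b) n (subst W e y)                      ∎
  where
  open ≡-Reasoning
  e′ : a + (b + n) ≡ (a + b) + n
  e′ = suc-injective e

IsMor-subst : ∀ {σ a b} (e : a ≡ b) {f : X → W a} → IsMor σ a f → IsMor σ b (subst W e ∘ f)
IsMor-subst refl f-mor = f-mor

record Lift (σ : X → X) (n : ℕ) (φ : X → W n) : Set where
  field
    depth : ℕ
    ψ     : X → W (suc depth + n)
    ψ-mor : IsMor σ (suc depth + n) ψ
    lifts : ∀ x → φ x ≡ ξ (suc depth) n (ψ x)
open Lift

module _ {σ : X → X} (lifting : Lifting σ) where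

  lift-once : ∀ {n φ} → 1 ≤ n → IsMor σ n φ → Lift σ n φ
  lift-once 1≤n φ-mor with lifting 0 _ 1≤n _ φ-mor
  ... | suc k , _ , ψ , ψ-mor , _ , lifts = record { depth = k ; ψ = ψ ; ψ-mor = ψ-mor ; lifts = lifts }

  deepen : ∀ {n φ} (L : Lift σ n φ) → Σ (Lift σ n φ) λ L′ → depth L < depth L′
  deepen {n} {φ} L = record { depth = k + suc d ; ψ = subst W e ∘ ψ L′ ; ψ-mor = IsMor-subst e (ψ-mor L′)
                            ; lifts = lifts-through-L′ }
                   , m≤n+m (suc d) k
    where
    d : ℕ
    d = depth L
    L′ : Lift σ (suc d + n) (ψ L)
    L′ = lift-once (s≤s z≤n) (ψ-mor L)
    k : ℕ
    k = depth L′
    e : suc k + (suc d + n) ≡ suc (k + suc d) + n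
    e = cong suc (sym (+-assoc k (suc d) n))
    lifts-through-L′ : ∀ x → φ x ≡ ξ (suc k + suc d) n (subst W e (ψ L′ x))
    lifts-through-L′ x = begin
      φ x                                          ≡⟨ lifts L x ⟩
      ξ (suc d) n (ψ L x)                          ≡⟨ cong (ξ (suc d) n) (lifts L′ x) ⟩
      ξ (suc d) n (ξ (suc k) (suc d + n) (ψ L′ x)) ≡⟨ ξ-∘ (suc k) (suc d) n e (ψ L′ x) ⟩
      ξ (suc k + suc d) n (subst W e (ψ L′ x))     ∎
      where open ≡-Reasoning

  lift-of-depth : ∀ {n φ} → 1 ≤ n → IsMor σ n φ → ∀ i → Σ (Lift σ n φ) λ L → i ≤ depth L
  lift-of-depth 1≤n φ-mor zero = lift-once 1≤n φ-mor , z≤n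
  lift-of-depth 1≤n φ-mor (suc i) with lift-of-depth 1≤n φ-mor i
  ... | L , i≤d with deepen L
  ... | L′ , d<d′ = L′ , ≤-trans (s≤s i≤d) d<d′

-- The partition attached to a lift

module _ {σ : X → X} {n : ℕ} {φ : X → W n} (L : Lift σ n φ) where

  private
    encoding : Classes n ↔ Fin (proj₁ (finite-Classes n))
    encoding = proj₂ (finite-Classes n)
    open Inverse encoding using (to; from; strictlyInverseˡ; strictlyInverseʳ)

  classOf : W (suc (depth L) + n) → Classes n
  classOf y = ξ (suc (depth L)) n y , label y

  partition : X → Fin (proj₁ (finite-Classes n))
  partition = to ∘ classOf ∘ ψ L

  partition⇒classOf : ∀ {x y} → partition x ≡ partition y → classOf (ψ L x) ≡ classOf (ψ L y)
  partition⇒classOf e = trans (sym (strictlyInverseʳ _)) (trans (cong from e) (strictlyInverseʳ _))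

  partition-continuous : Cont partition
  partition-continuous with proj₁ (ψ-mor L)
  ... | N , ψ-cont = N , λ x y agree → cong (to ∘ classOf) (ψ-cont x y agree)

  partition-refines : Refines partition φ
  partition-refines x y e = trans (lifts L x) (trans (cong proj₁ (partition⇒classOf e)) (sym (lifts L y)))

  classOf-adjustable : ∀ x b → ∃ λ y → classOf y ≡ (φ x , b)
  classOf-adjustable x b with label-adjustable (ψ L x) b
  ... | y , ξ₁y≡ξ₁ψx , label≡b = y , cong₂ _,_ (trans (cong (ξ (depth L) n) ξ₁y≡ξ₁ψx) (sym (lifts L x))) label≡b

  partition-surjective : Surj φ → Surj partition
  partition-surjective φ-surj c with φ-surj (proj₁ (from c))
  ... | x₀ , φx₀≡ with classOf-adjustable x₀ (proj₂ (from c))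
  ... | y , classOf-y with proj₁ (proj₂ (ψ-mor L)) y
  ... | x₁ , ψx₁≡y = x₁ , (begin
    to (classOf (ψ L x₁))        ≡⟨ cong (to ∘ classOf) ψx₁≡y ⟩
    to (classOf y)               ≡⟨ cong to (trans classOf-y (cong (_, proj₂ (from c)) φx₀≡)) ⟩
    to (from c)                  ≡⟨ strictlyInverseˡ c ⟩
    c                            ∎)
    where open ≡-Reasoning

  partition-unrefinable : ∀ {τ : X → X} → (∀ x → σ (τ x) ≈X x) → ∀ {M} → M ! < (suc (depth L) + n) ! →
    {ψ′ : X → W M} → IsMor σ M ψ′ → ¬ Refines ψ′ partition
  partition-unrefinable {τ} στ≈id M!< ψ′-mor refines =
    label-unrefinable {τ = τ} στ≈id M!< ψ′-mor (ψ-mor L) (λ x y e → cong proj₂ (partition⇒classOf (refines x y e)))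

lemma3p2 : (σ : X → X) → IsHomeo σ → Lifting σ →
    (n : ℕ) → 1 ≤ n → (φ : X → W n) → IsMor σ n φ →
    ∃ λ (c : ℕ) → Σ (ℕ → X → Fin c) λ P →
      (∀ i → Cont (P i)) × (∀ i → Surj (P i)) × (∀ i → Refines (P i) φ) ×
      ¬ (∃ λ k → 1 ≤ k × (∀ N → ∃ λ i → N ≤ i × Σ (X → W (k + n)) λ ψ →
          IsMor σ (k + n) ψ × Refines ψ (P i) × (∀ x → φ x ≡ ξ k n (ψ x))))
lemma3p2 σ (_ , τ , _ , στ≈id , _) lifting n 1≤n φ φ-mor =
  proj₁ (finite-Classes n) , partition ∘ lift ,
  partition-continuous ∘ lift , (λ i → partition-surjective (lift i) (proj₁ (proj₂ φ-mor))) ,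
  partition-refines ∘ lift , no-refinement-at-fixed-depth
  where
  lift : ℕ → Lift σ n φ
  lift i = proj₁ (lift-of-depth lifting 1≤n φ-mor i)

  no-refinement-at-fixed-depth : ¬ (∃ λ k → 1 ≤ k × (∀ N → ∃ λ i → N ≤ i × Σ (X → W (k + n)) λ ψ →
    IsMor σ (k + n) ψ × Refines ψ (partition (lift i)) × (∀ x → φ x ≡ ξ k n (ψ x))))
  no-refinement-at-fixed-depth (k , _ , refinable) with refinable k
  ... | i , k≤i , _ , ψ-mor , refines , _ =
    partition-unrefinable (lift i) {τ} στ≈id (!-mono-< 1≤k+n k+n<level) ψ-mor refines
    where
    1≤k+n : 1 ≤ k + n
    1≤k+n = ≤-trans 1≤n (m≤n+m n k)
    k+n<level : k + n < suc (depth (lift i)) + n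
    k+n<level = +-monoˡ-< n (s≤s (≤-trans k≤i (proj₂ (lift-of-depth lifting 1≤n φ-mor i))))
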